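{- For an integer $q\ge 1$, let $L(q)$ be the minimum, over all infinite 2D words $w$ with $|Alph(w)|=q$, of the number of distinct non-empty HV-palindromic factors of $w$. Then $L(1)=\infty$, $L(2)=14$, and $L(q)=q$ for every $q\ge 3$.
   Context: An infinite 2D word over a finite alphabet $\Sigma$ is an array $w=[w_{i,j}]_{i,j\ge 1}$ with entries in $\Sigma$ (infinitely many rows and columns). $Alph(w)$ is the set of letters occurring in $w$. A factor of $w$ is a finite sub-array $[w_{i,j}]_{a\le i\le b,\,c\le j\le d}$ of consecutive rows and columns, considered as a finite 2D word; factors are counted as distinct arrays, independently of their positions. A 1D word is a palindrome if it equals its reversal, and a finite 2D word is an HV-palindrome if each of its rows and each of its columns is a 1D palindrome. -}

module Defs where

open import Data.Nat using (ℕ; _+_; _≤_)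
open import Data.Fin using (Fin; toℕ)
open import Data.Vec using (Vec; tabulate; reverse; transpose)
open import Data.Vec.Relation.Unary.All using (All)
open import Data.List using (List; length)
open import Data.List.Relation.Unary.Unique.Propositional using (Unique)
import Data.List.Relation.Unary.All as LAll
open import Data.List.Membership.Propositional using (_∈_)
open import Data.Product using (Σ; Σ-syntax; ∃; ∃-syntax; _×_; _,_)
open import Relation.Binary.PropositionalEquality using (_≡_)

Word2D : Set → Set
Word2D A = ℕ → ℕ → A

-- Alph(w) = all of Fin q, i.e. |Alph(w)| = q after naming the letters 0 … q-1.
AlphIsAll : ∀ {q} → Word2D (Fin q) → Set
AlphIsAll {q} w = (x : Fin q) → ∃[ i ] ∃[ j ] w i j ≡ x

Array2D : Set → Set
Array2D A = Σ[ m ∈ ℕ ] Σ[ n ∈ ℕ ] Vec (Vec A n) m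

factorAt : ∀ {A} → Word2D A → (a c m n : ℕ) → Vec (Vec A n) m
factorAt w a c m n = tabulate (λ i → tabulate (λ j → w (a + toℕ i) (c + toℕ j)))

IsFactor : ∀ {A} → Word2D A → Array2D A → Set
IsFactor w (m , n , u) = ∃[ a ] ∃[ c ] u ≡ factorAt w a c m n

NonEmpty : ∀ {A} → Array2D A → Set
NonEmpty (m , n , u) = (1 ≤ m) × (1 ≤ n)

IsPal : ∀ {A} {n} → Vec A n → Set
IsPal v = reverse v ≡ v

HVPal : ∀ {A} → Array2D A → Set
HVPal (m , n , u) = All IsPal u × All IsPal (transpose u)

PalFactor : ∀ {A} → Word2D A → Array2D A → Set
PalFactor w u = IsFactor w u × NonEmpty u × HVPal u

AtLeastPal : ∀ {A} → Word2D A → ℕ → Set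
AtLeastPal {A} w k = Σ[ us ∈ List (Array2D A) ]
  (length us ≡ k × Unique us × LAll.All (PalFactor w) us)

ExactlyPal : ∀ {A} → Word2D A → ℕ → Set
ExactlyPal {A} w k = Σ[ us ∈ List (Array2D A) ]
  (length us ≡ k × Unique us × LAll.All (PalFactor w) us
   × (∀ u → PalFactor w u → u ∈ us))

-- L(q) = ∞ : every word with |Alph(w)| = q has infinitely many such factors
LInfinite : ℕ → Set
LInfinite q = (w : Word2D (Fin q)) → AlphIsAll w → ∀ k → AtLeastPal w k

-- L(q) = k : some word attains exactly k, and every word has at least k
LEquals : ℕ → ℕ → Set
LEquals q k = (Σ[ w ∈ Word2D (Fin q) ] (AlphIsAll w × ExactlyPal w k))
  × ((w : Word2D (Fin q)) → AlphIsAll w → AtLeastPal w k)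

-- Peeling the two end letters off a palindrome leaves a palindrome, so a one-sided word with no
-- palindromic factor of length k or k + 1 has none of length ≥ k.  The first row and the first column
-- of an HV-palindromic factor are palindromes, so on a word w i j = x (i + j) built from such an x
-- every HV-palindromic factor is smaller than k × k.  For q ≥ 3, x t = t mod q has no palindromes of
-- length 2 or 3, so the only HV-palindromic factors are the q letters, and q is also a lower bound
-- because every letter is one.  For q = 2, x = (001011)^ω has no palindromes of length 5 or 6, and by
-- periodicity a finite check shows it has exactly 14 HV-palindromic factors.  Conversely an exhaustive
-- check shows that every binary word of length 9 has at least 8 distinct non-empty palindromic factors,
-- at least 6 of length ≥ 2: read the former as rows in the first row of a binary 2D word and the latter
-- as columns in its first column to get 14 distinct HV-palindromic factors.  Over one letter every
-- row 0ⁿ is an HV-palindromic factor.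
module Submission where

open import Defs
open import Data.Nat
  using (ℕ; zero; suc; _+_; _∸_; _*_; _/_; _%_; _≤_; _<_; z≤n; s≤s; _≤?_; _<?_; NonZero)
open import Data.Nat.Properties using (+-suc; +-comm; +-assoc; +-identityʳ; m∸n+n≡m; ≮⇒≥)
import Data.Nat.Properties as ℕ
open import Data.Nat.DivMod using (_mod_; m≡m%n+[m/n]*n; m<n⇒m%n≡m; m%n<n; %-distribˡ-+; m%n%n≡m%n)
open import Data.Nat.Divisibility using (_∣_; ∣m+n∣m⇒∣n; n∣m*n; ∣⇒≤)
open import Data.Nat.Tactic.RingSolver using (solve-∀)
open import Data.Fin using (Fin; toℕ; fromℕ<)
open import Data.Fin.Patterns using (0F; 1F)
import Data.Fin.Properties as Fin
open import Data.Vec using (Vec; []; _∷_; [_]; _∷ʳ_; tabulate; reverse; transpose; lookup; map; replicate; _⊛_)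
open import Data.Vec.Properties
  using ( reverse-∷; reverse-reverse; ∷ʳ-injectiveˡ; tabulate-cong; tabulate-∘
        ; lookup-⊛; lookup-replicate; lookup∘tabulate)
import Data.Vec.Properties as Vec
import Data.Vec.Relation.Unary.All as VAll
import Data.Vec.Relation.Unary.All.Properties as VAll
open import Data.List using (List; length; take; _++_; allFin; upTo; filter; deduplicate; cartesianProduct)
import Data.List as List
import Data.List.Properties as List
import Data.List.Relation.Unary.All as LAll
import Data.List.Relation.Unary.All.Properties as LAll
open import Data.List.Relation.Unary.Unique.Propositional using (Unique)
import Data.List.Relation.Unary.Unique.Propositional.Properties as Unique
open import Data.List.Relation.Unary.Unique.DecPropositional using (unique?)
open import Data.List.Relation.Unary.Unique.DecPropositional.Properties using (deduplicate-!)
open import Data.List.Membership.Propositional using (_∈_)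
open import Data.List.Membership.Propositional.Properties
  using (∈-map⁺; ∈-map⁻; ∈-allFin; ∈-filter⁻; ∈-deduplicate⁻)
open import Data.List.Membership.DecPropositional using (_∈?_)
open import Data.Product using (Σ; _×_; _,_; proj₁; proj₂; ∃-syntax)
import Data.Product.Properties as Product
open import Data.Empty using (⊥-elim)
open import Function using (_∘_; _$_)
open import Relation.Binary.Definitions using (DecidableEquality)
open import Relation.Binary.PropositionalEquality
  using (_≡_; _≢_; refl; sym; trans; cong; cong₂; subst; module ≡-Reasoning)
open import Relation.Nullary using (¬_; Dec; yes; no)
open import Relation.Nullary.Decidable using (_×-dec_; _→-dec_; ¬?; from-yes; map′)
open import Relation.Unary using (Decidable)

open ≡-Reasoning

private variable
  A : Set
  k m n : ℕ

segment : (ℕ → A) → ℕ → (n : ℕ) → Vec A n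
segment x c n = tabulate (λ j → x (c + toℕ j))

palindrome-peel : ∀ (a b : A) (v : Vec A n) → IsPal (a ∷ (v ∷ʳ b)) → IsPal v
palindrome-peel a b v pal = sym (∷ʳ-injectiveˡ v (reverse v) (begin
  v ∷ʳ b             ≡⟨ reverse-reverse outer ⟨
  reverse (a ∷ v)    ≡⟨ reverse-∷ a v ⟩
  reverse v ∷ʳ a     ∎))
  where
    outer : reverse (v ∷ʳ b) ≡ a ∷ v
    outer = ∷ʳ-injectiveˡ (reverse (v ∷ʳ b)) (a ∷ v) (trans (sym (reverse-∷ a (v ∷ʳ b))) pal)

segment-∷ʳ : ∀ (x : ℕ → A) c n → segment x c (suc n) ≡ segment x c n ∷ʳ x (c + n)
segment-∷ʳ x c zero    = refl
segment-∷ʳ x c (suc n) = cong (x (c + 0) ∷_) (segment-∷ʳ (λ t → x (c + suc t)) 0 n)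

segment-peel : ∀ (x : ℕ → A) c n →
               segment x c (2 + n) ≡ x (c + 0) ∷ (segment x (suc c) n ∷ʳ x (c + suc n))
segment-peel x c n = cong (x (c + 0) ∷_) (begin
  segment (λ t → x (c + suc t)) 0 (suc n)              ≡⟨ segment-∷ʳ (λ t → x (c + suc t)) 0 n ⟩
  segment (λ t → x (c + suc t)) 0 n ∷ʳ x (c + suc n)   ≡⟨ cong (_∷ʳ x (c + suc n)) inner ⟩
  segment x (suc c) n ∷ʳ x (c + suc n)                 ∎)
  where
    inner : segment (λ t → x (c + suc t)) 0 n ≡ segment x (suc c) n
    inner = tabulate-cong (λ j → cong x (+-suc c (toℕ j)))

palindromic-segment-peel : ∀ (x : ℕ → A) c n → IsPal (segment x c (2 + n)) → IsPal (segment x (suc c) n)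
palindromic-segment-peel x c n pal =
  palindrome-peel _ _ (segment x (suc c) n) (subst IsPal (segment-peel x c n) pal)

PalFreeFrom : ℕ → (ℕ → A) → Set
PalFreeFrom k x = ∀ c o → ¬ IsPal (segment x c (o + k))

palFreeFrom⁺ : ∀ {x : ℕ → A} →
               (∀ c → ¬ IsPal (segment x c k)) → (∀ c → ¬ IsPal (segment x c (suc k))) → PalFreeFrom k x
palFreeFrom⁺ noK noK+1 c zero                   = noK c
palFreeFrom⁺ noK noK+1 c (suc zero)             = noK+1 c
palFreeFrom⁺ {x = x} noK noK+1 c (suc (suc o)) =
  palFreeFrom⁺ {x = x} noK noK+1 (suc c) o ∘ palindromic-segment-peel x c _

palFreeFrom-shift : ∀ {x y : ℕ → A} s → (∀ t → y t ≡ x (s + t)) → PalFreeFrom k x → PalFreeFrom k y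
palFreeFrom-shift {x = x} s y≡x free c o =
  free (s + c) o ∘ subst IsPal (tabulate-cong (λ j → trans (y≡x _) (cong x (sym (+-assoc s c (toℕ j))))))

palFreeFrom⇒< : ∀ {x : ℕ → A} {c} → PalFreeFrom k x → IsPal (segment x c n) → n < k
palFreeFrom⇒< {k = k} {n = n} {x = x} {c} free pal with n <? k
... | yes n<k = n<k
... | no  n≮k =
  ⊥-elim (free c (n ∸ k) (subst (IsPal ∘ segment x c) (sym (m∸n+n≡m (≮⇒≥ n≮k))) pal))

isPal? : DecidableEquality A → (v : Vec A n) → Dec (IsPal v)
isPal? _≟_ v = Vec.≡-dec _≟_ (reverse v) v

lookup-transpose : ∀ (u : Vec (Vec A n) m) j → lookup (transpose u) j ≡ map (λ r → lookup r j) u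
lookup-transpose []      j = lookup-replicate j []
lookup-transpose (r ∷ u) j = begin
  lookup (replicate _ _∷_ ⊛ r ⊛ transpose u) j             ≡⟨ lookup-⊛ j (replicate _ _∷_ ⊛ r) (transpose u) ⟩
  lookup (replicate _ _∷_ ⊛ r) j (lookup (transpose u) j)  ≡⟨ cong₂ _$_ head (lookup-transpose u j) ⟩
  lookup r j ∷ map (λ r → lookup r j) u                     ∎
  where
    head : lookup (replicate _ _∷_ ⊛ r) j ≡ lookup r j ∷_
    head = trans (lookup-⊛ j (replicate _ _∷_) r) (cong (_$ lookup r j) (lookup-replicate j _∷_))

factor-row-palindrome : ∀ (w : Word2D A) {a c} → HVPal (m , n , factorAt w a c m n) →
                        ∀ i → IsPal (segment (w (a + toℕ i)) c n)
factor-row-palindrome w (rows , _) = VAll.tabulate⁻ rows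

factor-column-palindrome : ∀ (w : Word2D A) {a c} → HVPal (m , n , factorAt w a c m n) →
                           ∀ j → IsPal (segment (λ i → w i (c + toℕ j)) a m)
factor-column-palindrome w {a} {c} (_ , columns) j = subst IsPal column (VAll.lookup⁺ columns j)
  where
    column : lookup (transpose (factorAt w a c _ _)) j ≡ segment (λ i → w i (c + toℕ j)) a _
    column = trans (lookup-transpose _ j)
               (trans (sym (tabulate-∘ (λ r → lookup r j) _)) (tabulate-cong (λ i → lookup∘tabulate _ j)))

palFactor-size : ∀ {w : Word2D A} {u} →
                 (∀ i → PalFreeFrom k (w i)) → (∀ j → PalFreeFrom k (λ i → w i j)) →
                 PalFactor w (m , n , u) → m < k × n < k
palFactor-size {w = w} rowsFree columnsFree ((a , c , refl) , (s≤s _ , s≤s _) , hv) =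
  palFreeFrom⇒< {x = λ i → w i (c + 0)} (columnsFree _) (factor-column-palindrome w hv 0F) ,
  palFreeFrom⇒< {x = w (a + 0)} (rowsFree _) (factor-row-palindrome w hv 0F)

hvPal? : DecidableEquality A → (u : Array2D A) → Dec (HVPal u)
hvPal? _≟_ (m , n , u) = VAll.all? (isPal? _≟_) u ×-dec VAll.all? (isPal? _≟_) (transpose u)

array-≟ : DecidableEquality A → DecidableEquality (Array2D A)
array-≟ _≟_ = Product.≡-dec ℕ._≟_ (Product.≡-dec ℕ._≟_ (Vec.≡-dec (Vec.≡-dec _≟_)))

diagonal : (ℕ → A) → Word2D A
diagonal x i j = x (i + j)

diagonal-palFactor-size : ∀ {x : ℕ → A} {u} →
                          PalFreeFrom k x → PalFactor (diagonal x) (m , n , u) → m < k × n < k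
diagonal-palFactor-size {x = x} free =
  palFactor-size {w = diagonal x}
    (λ i → palFreeFrom-shift {x = x} {y = λ t → x (i + t)} i (λ _ → refl) free)
    (λ j → palFreeFrom-shift {x = x} {y = λ t → x (t + j)} j (λ t → cong x (+-comm t j)) free)

factorAt-diagonal : ∀ (x : ℕ → A) {a c} s → (∀ t → x (a + c + t) ≡ x (s + t)) →
                    factorAt (diagonal x) a c m n ≡ factorAt (diagonal x) 0 s m n
factorAt-diagonal x {a} {c} s shift = tabulate-cong λ i → tabulate-cong λ j → begin
  x (a + toℕ i + (c + toℕ j))   ≡⟨ cong x (regroup a c (toℕ i) (toℕ j)) ⟩
  x (a + c + (toℕ i + toℕ j))   ≡⟨ shift _ ⟩
  x (s + (toℕ i + toℕ j))       ≡⟨ cong x (left-comm s (toℕ i) (toℕ j)) ⟩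
  x (toℕ i + (s + toℕ j))       ∎
  where
    regroup : ∀ a c i j → a + i + (c + j) ≡ a + c + (i + j)
    regroup = solve-∀
    left-comm : ∀ s i j → s + (i + j) ≡ i + (s + j)
    left-comm = solve-∀

atLeastPal-take : ∀ {w : Word2D A} us →
                  Unique us → LAll.All (PalFactor w) us → k ≤ length us → AtLeastPal w k
atLeastPal-take {k = k} us unique palFactors k≤ =
  take k us , trans (List.length-take k us) (ℕ.m≤n⇒m⊓n≡m k≤) ,
  Unique.take⁺ k unique , LAll.take⁺ k palFactors

all-pal-length1 : (u : Vec (Vec A 1) m) → VAll.All IsPal u
all-pal-length1 = VAll.universal (λ { (a ∷ []) → refl })

singleton : A → Array2D A
singleton a = 1 , 1 , (a ∷ []) ∷ []

singleton-palFactor : ∀ (w : Word2D A) i j → PalFactor w (singleton (w i j))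
singleton-palFactor w i j =
  (i , j , cong₂ (λ a b → (w a b ∷ []) ∷ []) (sym (+-identityʳ i)) (sym (+-identityʳ j))) ,
  (s≤s z≤n , s≤s z≤n) , (all-pal-length1 _ , all-pal-length1 _)

letters : ∀ q → List (Array2D (Fin q))
letters q = List.map singleton (allFin q)

length-letters : ∀ q → length (letters q) ≡ q
length-letters q = trans (List.length-map singleton (allFin q)) (List.length-tabulate _)

unique-letters : ∀ q → Unique (letters q)
unique-letters q = Unique.map⁺ (λ { refl → refl }) (Unique.allFin⁺ q)

letters-palFactor : ∀ {q} {w : Word2D (Fin q)} → AlphIsAll w → LAll.All (PalFactor w) (letters q)
letters-palFactor {w = w} alph = LAll.map⁺ (LAll.tabulate⁺ occurs)
  where
    occurs : ∀ a → PalFactor w (singleton a)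
    occurs a with alph a
    ... | i , j , refl = singleton-palFactor w i j

atLeastPal-letters : ∀ {q} (w : Word2D (Fin q)) → AlphIsAll w → AtLeastPal w q
atLeastPal-letters {q} w alph = letters q , length-letters q , unique-letters q , letters-palFactor alph

PalSegment : (ℕ → A) → ℕ → Σ ℕ (Vec A) → Set
PalSegment x lo (n , u) = lo ≤ n × IsPal u × ∃[ c ] u ≡ segment x c n

rowArray : Σ ℕ (Vec A) → Array2D A
rowArray (n , u) = 1 , n , u ∷ []

columnArray : Σ ℕ (Vec A) → Array2D A
columnArray (n , u) = n , 1 , map [_] u

transposeArray : Array2D A → Array2D A
transposeArray (m , n , u) = n , m , transpose u

transpose-column : ∀ (u : Vec A n) → transpose (map [_] u) ≡ u ∷ []
transpose-column []      = refl
transpose-column (a ∷ u) = cong ((_∷_ a ∷ []) ⊛_) (transpose-column u)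

rowArray-injective : ∀ {e e' : Σ ℕ (Vec A)} → rowArray e ≡ rowArray e' → e ≡ e'
rowArray-injective refl = refl

columnArray-injective : ∀ {e e' : Σ ℕ (Vec A)} → columnArray e ≡ columnArray e' → e ≡ e'
columnArray-injective {e = e} {e'} eq = rowArray-injective (begin
  rowArray e                        ≡⟨ transposed e ⟨
  transposeArray (columnArray e)    ≡⟨ cong transposeArray eq ⟩
  transposeArray (columnArray e')   ≡⟨ transposed e' ⟩
  rowArray e'                       ∎)
  where
    transposed : ∀ (e : Σ ℕ (Vec A)) → transposeArray (columnArray e) ≡ rowArray e
    transposed (n , u) = cong (λ v → 1 , n , v) (transpose-column u)

rowArray-palFactor : ∀ (w : Word2D A) {lo e} → PalSegment (w 0) (suc lo) e → PalFactor w (rowArray e)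
rowArray-palFactor w (lo<n , pal , c , refl) =
  (0 , c , refl) , (s≤s z≤n , ℕ.≤-trans (s≤s z≤n) lo<n) , (pal VAll.∷ VAll.[] , all-pal-length1 _)

columnArray-palFactor : ∀ (w : Word2D A) {lo e} →
                        PalSegment (λ i → w i 0) (suc lo) e → PalFactor w (columnArray e)
columnArray-palFactor w (lo<n , pal , a , refl) =
  (a , 0 , sym (tabulate-∘ [_] _)) , (ℕ.≤-trans (s≤s z≤n) lo<n , s≤s z≤n) ,
  (all-pal-length1 _ , subst (VAll.All IsPal) (sym (transpose-column _)) (pal VAll.∷ VAll.[]))

-- One letter

vec-fin1-unique : (u v : Vec (Fin 1) n) → u ≡ v
vec-fin1-unique []       []       = refl
vec-fin1-unique (0F ∷ u) (0F ∷ v) = cong (0F ∷_) (vec-fin1-unique u v)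

unary-infinite : LInfinite 1
unary-infinite w _ k =
  atLeastPal-take {w = w} (List.map row (upTo k)) (Unique.map⁺ row-injective (Unique.upTo⁺ k))
    (LAll.map⁺ (LAll.universal row-palFactor (upTo k))) (ℕ.≤-reflexive (sym length-rows))
  where
    row : ℕ → Array2D (Fin 1)
    row n = rowArray (suc n , segment (w 0) 0 (suc n))
    row-injective : ∀ {n n'} → row n ≡ row n' → n ≡ n'
    row-injective refl = refl
    row-palFactor : ∀ n → PalFactor w (row n)
    row-palFactor n = rowArray-palFactor w {lo = 0} (s≤s z≤n , vec-fin1-unique _ _ , 0 , refl)
    length-rows : length (List.map row (upTo k)) ≡ k
    length-rows = trans (List.length-map row (upTo k)) (List.length-upTo k)

-- At least three letters

[m+n]%o≡m%o⇒o∣n : ∀ m n o .{{_ : NonZero o}} → (m + n) % o ≡ m % o → o ∣ n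
[m+n]%o≡m%o⇒o∣n m n o eq =
  ∣m+n∣m⇒∣n (subst (o ∣_) (sym multiple) (n∣m*n ((m + n) / o))) (n∣m*n (m / o))
  where
    multiple : m / o * o + n ≡ (m + n) / o * o
    multiple = ℕ.+-cancelˡ-≡ (m % o) _ _ (begin
      m % o + (m / o * o + n)        ≡⟨ +-assoc (m % o) _ n ⟨
      m % o + m / o * o + n          ≡⟨ cong (_+ n) (m≡m%n+[m/n]*n m o) ⟨
      m + n                          ≡⟨ m≡m%n+[m/n]*n (m + n) o ⟩
      (m + n) % o + (m + n) / o * o  ≡⟨ cong (_+ (m + n) / o * o) eq ⟩
      m % o + (m + n) / o * o        ∎)

mod-≢ : ∀ q .{{_ : NonZero q}} t d → 0 < d → d < q → (t + d) mod q ≢ t mod q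
mod-≢ q t d 0<d@(s≤s _) d<q eq = ℕ.<⇒≱ d<q (∣⇒≤ ([m+n]%o≡m%o⇒o∣n t d q remainders))
  where
    remainders : (t + d) % q ≡ t % q
    remainders = trans (sym (Fin.toℕ-fromℕ< _)) (trans (cong toℕ eq) (Fin.toℕ-fromℕ< _))

cyclic-palFree : ∀ q .{{_ : NonZero q}} → 3 ≤ q → PalFreeFrom 2 (_mod q)
cyclic-palFree q 3≤q = palFreeFrom⁺ {x = _mod q} no-square no-cube
  where
    no-square : ∀ c → ¬ IsPal (segment (_mod q) c 2)
    no-square c pal = mod-≢ q c 1 (s≤s z≤n) (ℕ.<-≤-trans (s≤s (s≤s z≤n)) 3≤q)
                        (trans (Vec.∷-injectiveˡ pal) (cong (_mod q) (+-identityʳ c)))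
    no-cube : ∀ c → ¬ IsPal (segment (_mod q) c 3)
    no-cube c pal = mod-≢ q c 2 (s≤s z≤n) 3≤q
                      (trans (Vec.∷-injectiveˡ pal) (cong (_mod q) (+-identityʳ c)))

cyclic : ∀ q .{{_ : NonZero q}} → Word2D (Fin q)
cyclic q = diagonal (_mod q)

cyclic-alphabet : ∀ q .{{_ : NonZero q}} → AlphIsAll (cyclic q)
cyclic-alphabet q a = toℕ a , 0 , Fin.toℕ-injective (begin
  toℕ ((toℕ a + 0) mod q)  ≡⟨ Fin.toℕ-fromℕ< _ ⟩
  (toℕ a + 0) % q          ≡⟨ cong (_% q) (+-identityʳ (toℕ a)) ⟩
  toℕ a % q                ≡⟨ m<n⇒m%n≡m (Fin.toℕ<n a) ⟩
  toℕ a                    ∎)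

cyclic-palFactor⇒letter : ∀ q .{{_ : NonZero q}} → 3 ≤ q →
                          ∀ u → PalFactor (cyclic q) u → u ∈ letters q
cyclic-palFactor⇒letter q 3≤q (m , n , u) pf@((a , c , refl) , (s≤s _ , s≤s _) , _)
  with diagonal-palFactor-size {x = _mod q} (cyclic-palFree q 3≤q) pf
... | s≤s (s≤s z≤n) , s≤s (s≤s z≤n) = ∈-map⁺ singleton (∈-allFin _)

cyclic-exact : ∀ q → 3 ≤ q → LEquals q q
cyclic-exact q@(suc _) 3≤q =
  (cyclic q , cyclic-alphabet q , letters q , length-letters q , unique-letters q ,
   letters-palFactor (cyclic-alphabet q) , cyclic-palFactor⇒letter q 3≤q) ,
  atLeastPal-letters

-- Two letters: the lower bound

extend : A → Vec A n → ℕ → A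
extend d []      _       = d
extend d (a ∷ v) zero    = a
extend d (a ∷ v) (suc t) = extend d v t

prefix : (ℕ → A) → (n : ℕ) → Vec A n
prefix x n = tabulate (x ∘ toℕ)

extend-prefix : ∀ d (x : ℕ → A) {t} → t < n → extend d (prefix x n) t ≡ x t
extend-prefix {n = suc n} d x {zero}  _         = refl
extend-prefix {n = suc n} d x {suc t} (s≤s t<n) = extend-prefix d (x ∘ suc) t<n

segment-extend-prefix : ∀ d (x : ℕ → A) {N c} →
                        c + n ≤ N → segment (extend d (prefix x N)) c n ≡ segment x c n
segment-extend-prefix d x c+n≤N =
  tabulate-cong (λ j → extend-prefix d x (ℕ.<-≤-trans (ℕ.+-monoʳ-< _ (Fin.toℕ<n j)) c+n≤N))

module _ (_≟_ : DecidableEquality A) where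

  palindromicWindow? : (lo N : ℕ) (x : ℕ → A) →
                       Decidable (λ ((c , n) : ℕ × ℕ) → lo ≤ n × c + n ≤ N × IsPal (segment x c n))
  palindromicWindow? lo N x (c , n) = (lo ≤? n) ×-dec (c + n ≤? N) ×-dec isPal? _≟_ (segment x c n)

  palindromicSegments : (lo N : ℕ) → (ℕ → A) → List (Σ ℕ (Vec A))
  palindromicSegments lo N x =
    deduplicate (Product.≡-dec ℕ._≟_ (Vec.≡-dec _≟_))
      (List.map (λ (c , n) → n , segment x c n)
        (filter (palindromicWindow? lo N x) (cartesianProduct (upTo (suc N)) (upTo (suc N)))))

  palindromicSegments-unique : ∀ lo N x → Unique (palindromicSegments lo N x)
  palindromicSegments-unique lo N x = deduplicate-! (Product.≡-dec ℕ._≟_ (Vec.≡-dec _≟_)) _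

  palindromicSegments-prefix : ∀ d (x : ℕ → A) lo N →
                               LAll.All (PalSegment x lo) (palindromicSegments lo N (extend d (prefix x N)))
  palindromicSegments-prefix d x lo N = LAll.tabulate sound
    where
      sound : ∀ {e} → e ∈ palindromicSegments lo N (extend d (prefix x N)) → PalSegment x lo e
      sound e∈ with ∈-map⁻ _ (∈-deduplicate⁻ _ _ e∈)
      ... | (c , n) , p∈ , refl with ∈-filter⁻ (palindromicWindow? lo N (extend d (prefix x N))) p∈
      ... | _ , lo≤n , c+n≤N , pal = lo≤n , pal , c , segment-extend-prefix d x c+n≤N

all-vec? : ∀ {q} n {P : Vec (Fin q) n → Set} → Decidable P → Dec (∀ v → P v)
all-vec? zero    P? = map′ (λ { p [] → p }) (λ h → h []) (P? [])
all-vec? (suc n) P? = map′ (λ { h (a ∷ v) → h a v }) (λ h a v → h (a ∷ v))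
                        (Fin.all? (λ a → all-vec? n (λ v → P? (a ∷ v))))

binaryPalindromes : ℕ → Vec (Fin 2) 9 → List (Σ ℕ (Vec (Fin 2)))
binaryPalindromes lo v = palindromicSegments Fin._≟_ lo 9 (extend 0F v)

binaryPalindromes-count : ∀ v → 8 ≤ length (binaryPalindromes 1 v) × 6 ≤ length (binaryPalindromes 2 v)
binaryPalindromes-count = from-yes (all-vec? 9 λ v → (8 ≤? length (binaryPalindromes 1 v))
                                               ×-dec (6 ≤? length (binaryPalindromes 2 v)))

binary-atLeast14 : (w : Word2D (Fin 2)) → AtLeastPal w 14
binary-atLeast14 w = atLeastPal-take {w = w} (rows ++ columns) unique palFactors 14≤
  where
    row column : ℕ → Fin 2
    row = w 0
    column i = w i 0
    rowSegments columnSegments : List (Σ ℕ (Vec (Fin 2)))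
    rowSegments    = binaryPalindromes 1 (prefix row 9)
    columnSegments = binaryPalindromes 2 (prefix column 9)
    rows columns : List (Array2D (Fin 2))
    rows    = List.map rowArray rowSegments
    columns = List.map columnArray columnSegments
    rowsSound    = palindromicSegments-prefix Fin._≟_ 0F row 1 9
    columnsSound = palindromicSegments-prefix Fin._≟_ 0F column 2 9
    disjoint : ∀ {u} → ¬ (u ∈ rows × u ∈ columns)
    disjoint (u∈rows , u∈columns) with ∈-map⁻ rowArray u∈rows | ∈-map⁻ columnArray u∈columns
    ... | _ , _ , refl | _ , e∈ , eq
      with subst (2 ≤_) (sym (cong proj₁ eq)) (proj₁ (LAll.lookup columnsSound e∈))
    ... | s≤s ()
    unique : Unique (rows ++ columns)
    unique = Unique.++⁺
      (Unique.map⁺ rowArray-injective (palindromicSegments-unique Fin._≟_ 1 9 (extend 0F (prefix row 9))))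
      (Unique.map⁺ columnArray-injective (palindromicSegments-unique Fin._≟_ 2 9 (extend 0F (prefix column 9))))
      disjoint
    palFactors : LAll.All (PalFactor w) (rows ++ columns)
    palFactors = LAll.++⁺ (LAll.map⁺ (LAll.map (rowArray-palFactor w) rowsSound))
                          (LAll.map⁺ (LAll.map (columnArray-palFactor w) columnsSound))
    length-rows++columns : length (rows ++ columns) ≡ length rowSegments + length columnSegments
    length-rows++columns = trans (List.length-++ rows)
      (cong₂ _+_ (List.length-map rowArray rowSegments) (List.length-map columnArray columnSegments))
    14≤ : 14 ≤ length (rows ++ columns)
    14≤ = subst (14 ≤_) (sym length-rows++columns)
            (ℕ.+-mono-≤ (proj₁ (binaryPalindromes-count (prefix row 9)))
                        (proj₂ (binaryPalindromes-count (prefix column 9))))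

-- Two letters: the word (001011)^ω along the antidiagonals

block001011 : Vec (Fin 2) 6
block001011 = 0F ∷ 0F ∷ 1F ∷ 0F ∷ 1F ∷ 1F ∷ []

period6 : ℕ → Fin 2
period6 t = lookup block001011 (t mod 6)

period6-periodic : ∀ s t → period6 (s + t) ≡ period6 (toℕ (s mod 6) + t)
period6-periodic s t = cong (lookup block001011) (Fin.toℕ-injective (begin
  toℕ ((s + t) mod 6)               ≡⟨ Fin.toℕ-fromℕ< (m%n<n (s + t) 6) ⟩
  (s + t) % 6                       ≡⟨ %-distribˡ-+ s t 6 ⟩
  (s % 6 + t % 6) % 6               ≡⟨ cong (λ r → (r + t % 6) % 6) (m%n%n≡m%n s 6) ⟨
  (s % 6 % 6 + t % 6) % 6           ≡⟨ %-distribˡ-+ (s % 6) t 6 ⟨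
  (s % 6 + t) % 6                   ≡⟨ cong (λ r → (r + t) % 6) (Fin.toℕ-fromℕ< (m%n<n s 6)) ⟨
  (toℕ (s mod 6) + t) % 6           ≡⟨ Fin.toℕ-fromℕ< (m%n<n (toℕ (s mod 6) + t) 6) ⟨
  toℕ ((toℕ (s mod 6) + t) mod 6)   ∎))

period6-palFree : PalFreeFrom 5 period6
period6-palFree = palFreeFrom⁺ {x = period6} (short 5 (from-yes (decide 5))) (short 6 (from-yes (decide 6)))
  where
    decide : ∀ n → Dec (∀ (r : Fin 6) → ¬ IsPal (segment period6 (toℕ r) n))
    decide n = Fin.all? (λ r → ¬? (isPal? Fin._≟_ (segment period6 (toℕ r) n)))
    short : ∀ n → (∀ (r : Fin 6) → ¬ IsPal (segment period6 (toℕ r) n)) →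
            ∀ c → ¬ IsPal (segment period6 c n)
    short n none c = none (c mod 6) ∘ subst IsPal (tabulate-cong (λ j → period6-periodic c (toℕ j)))

period6Word : Word2D (Fin 2)
period6Word = diagonal period6

period6-alphabet : AlphIsAll period6Word
period6-alphabet 0F = 0 , 0 , refl
period6-alphabet 1F = 0 , 2 , refl

period6Factor : ℕ × ℕ × ℕ × ℕ → Array2D (Fin 2)
period6Factor (a , c , m , n) = m , n , factorAt period6Word a c m n

-- As rows, the palindromes 0, 1, 00, 11, 010, 101, 0110, 1001 of 001011001011…; as columns, those of length ≥ 2.
fourteenPositions : List (ℕ × ℕ × ℕ × ℕ)
fourteenPositions =
    (0 , 0 , 1 , 1) ∷ (0 , 2 , 1 , 1) ∷ (0 , 0 , 1 , 2) ∷ (0 , 4 , 1 , 2)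
  ∷ (0 , 1 , 1 , 3) ∷ (0 , 2 , 1 , 3) ∷ (0 , 3 , 1 , 4) ∷ (0 , 5 , 1 , 4)
  ∷ (0 , 0 , 2 , 1) ∷ (4 , 0 , 2 , 1) ∷ (1 , 0 , 3 , 1)
  ∷ (2 , 0 , 3 , 1) ∷ (3 , 0 , 4 , 1) ∷ (5 , 0 , 4 , 1) ∷ []
  where open Data.List using (_∷_; [])

fourteen : List (Array2D (Fin 2))
fourteen = List.map period6Factor fourteenPositions

fourteen-unique : Unique fourteen
fourteen-unique = from-yes (unique? (array-≟ Fin._≟_) fourteen)

fourteen-palFactor : LAll.All (PalFactor period6Word) fourteen
fourteen-palFactor = LAll.map⁺ (LAll.map (λ {p} → (proj₁ p , proj₁ (proj₂ p) , refl) ,_) palindromic)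
  where
    palindromic? : ∀ p → Dec (NonEmpty (period6Factor p) × HVPal (period6Factor p))
    palindromic? p@(_ , _ , m , n) = ((1 ≤? m) ×-dec (1 ≤? n)) ×-dec hvPal? Fin._≟_ (period6Factor p)
    palindromic : LAll.All (λ p → NonEmpty (period6Factor p) × HVPal (period6Factor p)) fourteenPositions
    palindromic = from-yes (LAll.all? palindromic? fourteenPositions)

fourteen-complete : ∀ u → PalFactor period6Word u → u ∈ fourteen
fourteen-complete (suc _ , suc _ , _) pf@((a , c , refl) , _ , hv)
  with diagonal-palFactor-size {x = period6} period6-palFree pf
... | s≤s m<4 , s≤s n<4
  with fromℕ< m<4 | Fin.toℕ-fromℕ< m<4 | fromℕ< n<4 | Fin.toℕ-fromℕ< n<4
... | i | refl | j | refl =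
  subst (λ v → (_ , _ , v) ∈ fourteen) (sym atOrigin)
    (from-yes atOrigin-complete ((a + c) mod 6) i j (subst (λ v → HVPal (_ , _ , v)) atOrigin hv))
  where
    atOrigin = factorAt-diagonal period6 {a} {c} (toℕ ((a + c) mod 6)) (period6-periodic (a + c))
    atOrigin-complete :
      Dec (∀ (r : Fin 6) (i j : Fin 4) →
           let u = period6Factor (0 , toℕ r , suc (toℕ i) , suc (toℕ j)) in HVPal u → u ∈ fourteen)
    atOrigin-complete = Fin.all? λ r → Fin.all? λ i → Fin.all? λ j →
                          hvPal? Fin._≟_ _ →-dec _∈?_ (array-≟ Fin._≟_) _ fourteen

binary-exact : LEquals 2 14
binary-exact =
  (period6Word , period6-alphabet , fourteen , refl , fourteen-unique , fourteen-palFactor , fourteen-complete) ,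
  λ w _ → binary-atLeast14 w

theorem5p12 : LInfinite 1 × LEquals 2 14 × ((q : ℕ) → 3 ≤ q → LEquals q q)
theorem5p12 = unary-infinite , binary-exact , cyclic-exact
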